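{- Let $n,k,\ell$ be positive integers with $\ell k\le n\le \ell(k+1)$ and $k>2$. Then $\mathcal{Z}_n^k$ has a contraction isomorphic to $\mathcal{Z}_{n-\ell}^{k-1}$.
   Context: $\mathcal{Z}_n^k$ is the clutter with vertex set $\mathbb{Z}_n$ whose circuits are the sets of $k$ consecutive elements $\{i,i+1,\dots,i+k-1\}$ (mod $n$), $i\in\mathbb{Z}_n$. For a clutter $\mathcal{C}$ on $V$ and $u\in V$, the contraction $\mathcal{C}/u$ is the clutter on $V\setminus\{u\}$ whose circuits are the inclusion-minimal sets among $\{e\setminus\{u\}: e\text{ a circuit}\}$; a contraction of $\mathcal{C}$ is a clutter obtained by a sequence of such contractions. Isomorphism of clutters means a bijection of vertex sets carrying circuits to circuits. -}

module Defs where

open import Data.Nat using (ℕ; zero; suc; _<_; _∸_; _+_)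
open import Data.Nat.DivMod using (_%_)
open import Data.Fin using (Fin; toℕ; punchIn)
open import Data.Fin.Subset using (Subset; _∈_; _⊂_; _-_)
open import Data.Product using (Σ; ∃; _×_)
open import Data.Empty using (⊥)
open import Relation.Nullary using (¬_)
open import Function.Bundles using (_⇔_; _↔_; Inverse)
open import Relation.Binary.PropositionalEquality using (_≡_)

-- A clutter on the vertex set Fin m, given by its family of circuits
-- (a predicate on subsets of Fin m).
Clutter : ℕ → Set₁
Clutter m = Subset m → Set

-- The cyclic clutter Z_n^k on vertex set Z_n = Fin n: circuits are the sets
-- {i, i+1, ..., i+k-1} (mod n), i.e. S is a circuit iff for some i,
-- j ∈ S  ⇔  (j - i) mod n < k.
Z : (n k : ℕ) → Clutter n
Z zero      k S = ⊥
Z (suc n′) k S =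
  Σ (Fin (suc n′)) λ i →
    (j : Fin (suc n′)) →
      (j ∈ S) ⇔ (((toℕ j + (suc n′ ∸ toℕ i)) % suc n′) < k)

-- Contraction C / u : clutter on V ∖ {u}, vertices of Fin m identified with
-- Fin (suc m) ∖ {u} via punchIn u.  Circuits are the inclusion-minimal sets
-- among { e ∖ {u} : e a circuit of C }.
_/_ : {m : ℕ} → Clutter (suc m) → Fin (suc m) → Clutter m
(C / u) S =
  Σ (Subset _) λ e →
    C e
    × ((j : Fin _) → (j ∈ S) ⇔ (punchIn u j ∈ e))
    × ¬ (Σ (Subset _) λ e′ → C e′ × ((e′ - u) ⊂ (e - u)))

data IsContraction : {m m′ : ℕ} → Clutter m → Clutter m′ → Set₁ where
  done : {m : ℕ} {C : Clutter m} → IsContraction C C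
  step : {m m′ : ℕ} {C : Clutter (suc m)} {D : Clutter m′} (u : Fin (suc m)) →
         IsContraction (C / u) D → IsContraction C D

image : {a b : ℕ} → Fin a ↔ Fin b → Subset a → Subset b
image {a} {b} σ S = Data.Vec.tabulate (λ j → Data.Vec.lookup S (Inverse.from σ j))
  where import Data.Vec

_≅_ : {a b : ℕ} → Clutter a → Clutter b → Set
_≅_ {a} {b} C D =
  Σ (Fin a ↔ Fin b) λ σ → (S : Subset a) → C S ⇔ D (image σ S)

-- Write M = n - ℓ and L = k - 1, so L ℓ ≤ M ≤ (L + 1) ℓ.  The map
-- F x = x + ⌊x ℓ / M⌋ embeds the cycle of length M into the cycle of length
-- n, strictly increasingly and missing ℓ vertices, spread so that L + 1
-- consecutive images skip at most one vertex and L + 2 skip at least one.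
-- Contracting the missed vertices gives Z_M^L.
module Submission where

open import Defs using (Clutter; IsContraction; done; step; Z; _/_; _≅_)
open import Data.Nat as ℕ using (ℕ; zero; suc; _+_; _*_; _∸_; _%_; _≤_; _<_; z≤n; s≤s; NonZero)
import Data.Nat.Properties as ℕ
open import Data.Nat.DivMod
  using (m%n<n; m≡m%n+[m/n]*n; [m+kn]%n≡m%n; [m+n]%n≡m%n; m<n⇒m%n≡m; m/n*n≤m; m<n*o⇒m/o<n; /-monoˡ-≤; m*n/n≡m; 0/n≡0)
open import Data.Nat.Tactic.RingSolver using (solve-∀)
open import Data.Fin as Fin using (Fin; punchIn; punchOut; toℕ; fromℕ<; opposite)
open import Data.Fin.Properties
  using (any?; all?; _≟_; punchInᵢ≢i; punchIn-punchOut; toℕ-injective; toℕ<n; toℕ-fromℕ<;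
         opposite-prop; opposite-involutive; injective⇒≤; toℕ-inject₁; punchIn-mono-≤)
open import Data.Fin.Subset using (Subset; _∈_; _∉_; _⊂_; _─_; _-_; ⁅_⁆; ∣_∣; inside)
open import Data.Fin.Subset.Properties
  using (_∈?_; anySubset?; p⊂q⇒∣p∣<∣q∣; p─q⊆p; x∈p∧x≢y⇒x∈p-y; x∈⁅x⁆)
open import Data.Vec using (_∷_; tabulate; lookup; here; there)
open import Data.Vec.Properties using (lookup∘tabulate; tabulate∘lookup; []=⇒lookup; lookup⇒[]=)
open import Data.Product using (Σ; ∃; _×_; _,_; proj₁; proj₂)
open import Data.Empty using (⊥-elim)
open import Function using (_∘_; id)
open import Function.Bundles using (_⇔_; mk⇔; Equivalence)
open import Function.Construct.Identity using (↔-id)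
import Function.Properties.Equivalence as ⇔
open import Relation.Binary.Core using (_Preserves_⟶_)
open import Relation.Nullary using (Dec; yes; no; does; ¬_)
open import Relation.Nullary.Decidable using (_×-dec_; _→-dec_; ¬?; map′; dec-true)
open import Relation.Unary using (Decidable)
open import Relation.Binary.PropositionalEquality
  using (_≡_; _≢_; refl; sym; trans; cong; subst; subst₂; _≗_; module ≡-Reasoning)

open Equivalence using () renaming (to to fwd; from to bwd)

infixr 5 _⟫_
_⟫_ : {A B C : Set} → A ⇔ B → B ⇔ C → A ⇔ C
_⟫_ = ⇔.trans

subst-⇔ : {A : Set} (P : A → Set) {x y : A} → x ≡ y → P x ⇔ P y
subst-⇔ P x≡y = mk⇔ (subst P x≡y) (subst P (sym x≡y))

_⇔-dec_ : {A B : Set} → Dec A → Dec B → Dec (A ⇔ B)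
a? ⇔-dec b? = map′ (λ (f , g) → mk⇔ f g) (λ e → fwd e , bwd e) ((a? →-dec b?) ×-dec (b? →-dec a?))

subsetOf : {N : ℕ} {P : Fin N → Set} → Decidable P → Subset N
subsetOf P? = tabulate (does ∘ P?)

∈-subsetOf : {N : ℕ} {P : Fin N → Set} (P? : Decidable P) (j : Fin N) → j ∈ subsetOf P? ⇔ P j
∈-subsetOf {P = P} P? j = mk⇔ to from
  where
  lookup≡ : lookup (subsetOf P?) j ≡ does (P? j)
  lookup≡ = lookup∘tabulate (does ∘ P?) j
  to : j ∈ subsetOf P? → P j
  to j∈ with P? j | trans (sym lookup≡) ([]=⇒lookup j∈)
  ... | yes p | _ = p
  ... | no _  | ()
  from : P j → j ∈ subsetOf P?
  from p = lookup⇒[]= j _ (trans lookup≡ (dec-true (P? j) p))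

x∈p─q⇒x∉q : {N : ℕ} {x : Fin N} (p q : Subset N) → x ∈ p ─ q → x ∉ q
x∈p─q⇒x∉q (_ ∷ p) (inside ∷ q) () here
x∈p─q⇒x∉q (_ ∷ p) (_ ∷ q) (there x∈) (there x∈q) = x∈p─q⇒x∉q p q x∈ x∈q

∈-minus : {N : ℕ} {x u : Fin N} (p : Subset N) → x ∈ p - u ⇔ (x ∈ p × x ≢ u)
∈-minus {x = x} {u} p = mk⇔
  (λ x∈ → p─q⊆p p ⁅ u ⁆ x∈ , λ { refl → x∈p─q⇒x∉q p ⁅ u ⁆ x∈ (x∈⁅x⁆ x) })
  (λ (x∈p , x≢u) → x∈p∧x≢y⇒x∈p-y x∈p x≢u)

Below : {m N : ℕ} → (Fin m → Fin N) → Subset N → Subset N → Set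
Below f e′ e = ∀ j → f j ∈ e′ → f j ∈ e

StrictlyBelow : {m N : ℕ} → (Fin m → Fin N) → Subset N → Subset N → Set
StrictlyBelow f e′ e = Below f e′ e × ∃ λ j → f j ∈ e × f j ∉ e′

Minimal : {m N : ℕ} → Clutter N → (Fin m → Fin N) → Subset N → Set
Minimal C f e = ¬ (∃ λ e′ → C e′ × StrictlyBelow f e′ e)

-- Contracting a vertex u is
-- restriction along punchIn u, and a contraction sequence is restriction
-- along the inclusion of the surviving vertices.
Restrict : {m N : ℕ} → Clutter N → (Fin m → Fin N) → Clutter m
Restrict C f S = ∃ λ e → C e × (∀ j → j ∈ S ⇔ f j ∈ e) × Minimal C f e

infix 4 _≋_
_≋_ : {m : ℕ} → Clutter m → Clutter m → Set
C ≋ D = ∀ S → C S ⇔ D S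

≋-trans : {m : ℕ} {C D E : Clutter m} → C ≋ D → D ≋ E → C ≋ E
≋-trans C≋D D≋E S = C≋D S ⟫ D≋E S

⊂-minus⇔strictlyBelow : {m : ℕ} (u : Fin (suc m)) (e′ e : Subset (suc m)) →
                        (e′ - u) ⊂ (e - u) ⇔ StrictlyBelow (punchIn u) e′ e
⊂-minus⇔strictlyBelow u e′ e = mk⇔ to from
  where
  punch≢ : ∀ j → punchIn u j ≢ u
  punch≢ = punchInᵢ≢i u
  to : (e′ - u) ⊂ (e - u) → StrictlyBelow (punchIn u) e′ e
  to (e′-u⊆e-u , x , x∈e-u , x∉e′-u) =
    (λ j j∈e′ → proj₁ (fwd (∈-minus e) (e′-u⊆e-u (bwd (∈-minus e′) (j∈e′ , punch≢ j))))) ,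
    punchOut u≢x , subst (_∈ e) (sym punch-x) x∈e ,
    λ x∈e′ → x∉e′-u (bwd (∈-minus e′) (subst (_∈ e′) punch-x x∈e′ , x≢u))
    where
    x∈e = proj₁ (fwd (∈-minus e) x∈e-u)
    x≢u = proj₂ (fwd (∈-minus e) x∈e-u)
    u≢x = x≢u ∘ sym
    punch-x : punchIn u (punchOut u≢x) ≡ x
    punch-x = punchIn-punchOut u≢x
  from : StrictlyBelow (punchIn u) e′ e → (e′ - u) ⊂ (e - u)
  from (below , j , j∈e , j∉e′) =
    (λ {x} x∈e′-u →
       let (x∈e′ , x≢u) = fwd (∈-minus e′) x∈e′-u
           punch-x = punchIn-punchOut {i = u} {j = x} (x≢u ∘ sym)
       in bwd (∈-minus e) (subst (_∈ e) punch-x (below _ (subst (_∈ e′) (sym punch-x) x∈e′)) , x≢u)) ,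
    punchIn u j , bwd (∈-minus e) (j∈e , punch≢ j) , λ j∈e′-u → j∉e′ (proj₁ (fwd (∈-minus e′) j∈e′-u))

contraction-as-restriction : {m : ℕ} (C : Clutter (suc m)) (u : Fin (suc m)) →
                             C / u ≋ Restrict C (punchIn u)
contraction-as-restriction C u S = mk⇔
  (λ (e , Ce , S≡ , min) → e , Ce , S≡ , λ (e′ , Ce′ , below) → min (e′ , Ce′ , bwd (⊂-minus⇔strictlyBelow u e′ e) below))
  (λ (e , Ce , S≡ , min) → e , Ce , S≡ , λ (e′ , Ce′ , e′⊂e) → min (e′ , Ce′ , fwd (⊂-minus⇔strictlyBelow u e′ e) e′⊂e))

/-resp-≋ : {m : ℕ} {C C′ : Clutter (suc m)} → C ≋ C′ → (u : Fin (suc m)) → C / u ≋ C′ / u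
/-resp-≋ {m} C≋C′ u S = mk⇔ (transport C≋C′) (transport (λ e → ⇔.sym (C≋C′ e)))
  where
  transport : {C C′ : Clutter (suc m)} → C ≋ C′ → (C / u) S → (C′ / u) S
  transport C≋C′ (e , Ce , S≡ , min) =
    e , fwd (C≋C′ e) Ce , S≡ , λ (e′ , C′e′ , e′⊂e) → min (e′ , bwd (C≋C′ e′) C′e′ , e′⊂e)

restrict-cong : {m N : ℕ} (C : Clutter N) {f g : Fin m → Fin N} → f ≗ g → Restrict C f ≋ Restrict C g
restrict-cong C f≗g S = mk⇔ (transport f≗g) (transport (sym ∘ f≗g))
  where
  transport : ∀ {f g} → f ≗ g → Restrict C f S → Restrict C g S
  transport {f} {g} f≗g (e , Ce , S≡ , min) =
    e , Ce , (λ j → S≡ j ⟫ ∈-same e j) , λ (e′ , Ce′ , below , j , j∈e , j∉e′) →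
      min (e′ , Ce′ , (λ i → bwd (∈-same e i) ∘ below i ∘ fwd (∈-same e′ i)) ,
           j , bwd (∈-same e j) j∈e , j∉e′ ∘ fwd (∈-same e′ j))
    where
    ∈-same : ∀ e j → f j ∈ e ⇔ g j ∈ e
    ∈-same e j = subst-⇔ (_∈ e) (f≗g j)

module Descent {N : ℕ} (C : Clutter N) (C? : Decidable C) where

  preimage : {m : ℕ} → (Fin m → Fin N) → Subset N → Subset m
  preimage f e = subsetOf (λ j → f j ∈? e)

  strictlyBelow? : {m : ℕ} (f : Fin m → Fin N) (e′ e : Subset N) → Dec (StrictlyBelow f e′ e)
  strictlyBelow? f e′ e =
    all? (λ j → (f j ∈? e′) →-dec (f j ∈? e)) ×-dec any? (λ j → (f j ∈? e) ×-dec ¬? (f j ∈? e′))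

  -- Descending strictly shrinks the preimage, so the size of the preimage
  -- bounds the length of the descent.
  preimage-⊂ : {m : ℕ} (f : Fin m → Fin N) {e′ e : Subset N} →
               StrictlyBelow f e′ e → preimage f e′ ⊂ preimage f e
  preimage-⊂ f {e′} {e} (below , j , j∈e , j∉e′) =
    (λ {i} i∈ → bwd (via e i) (below i (fwd (via e′ i) i∈))) ,
    j , bwd (via e j) j∈e , j∉e′ ∘ fwd (via e′ j)
    where
    via : ∀ e i → i ∈ preimage f e ⇔ f i ∈ e
    via e = ∈-subsetOf (λ i → f i ∈? e)

  minimalBelow : {m : ℕ} (f : Fin m → Fin N) (e : Subset N) → C e →
                 ∃ λ e₀ → C e₀ × Below f e₀ e × Minimal C f e₀
  minimalBelow f e Ce = descend (suc ∣ preimage f e ∣) e ℕ.≤-refl Ce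
    where
    descend : (bound : ℕ) (e : Subset N) → ∣ preimage f e ∣ ℕ.< bound → C e →
              ∃ λ e₀ → C e₀ × Below f e₀ e × Minimal C f e₀
    descend (suc bound) e size< Ce
      with anySubset? (λ e′ → C? e′ ×-dec strictlyBelow? f e′ e)
    ... | no none = e , Ce , (λ _ → id) , none
    ... | yes (e′ , Ce′ , strictly) =
      let (e₀ , Ce₀ , e₀≤e′ , min) =
            descend bound e′ (ℕ.<-≤-trans (p⊂q⇒∣p∣<∣q∣ (preimage-⊂ f strictly)) (ℕ.≤-pred size<)) Ce′
      in e₀ , Ce₀ , (λ j → proj₁ strictly j ∘ e₀≤e′ j) , min

  restrict-∘ : {m k : ℕ} (f : Fin m → Fin N) (g : Fin k → Fin m) →
               Restrict (Restrict C f) g ≋ Restrict C (f ∘ g)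
  restrict-∘ f g S = mk⇔ to from
    where
    induced : ∀ e₀ → C e₀ → Minimal C f e₀ → Restrict C f (preimage f e₀)
    induced e₀ Ce₀ min = e₀ , Ce₀ , ∈-subsetOf (λ i → f i ∈? e₀) , min
    to : Restrict (Restrict C f) g S → Restrict C (f ∘ g) S
    to (e₁ , (e , Ce , e₁≡ , _) , S≡ , min₁) =
      e , Ce , (λ j → S≡ j ⟫ e₁≡ (g j)) ,
      λ (e′ , Ce′ , below , j , j∈e , j∉e′) →
        let (e₀ , Ce₀ , e₀≤e′ , min₀) = minimalBelow f e′ Ce′
            via = ∈-subsetOf (λ i → f i ∈? e₀)
        in min₁ (preimage f e₀ , induced e₀ Ce₀ min₀ ,
                 (λ i → bwd (e₁≡ (g i)) ∘ below i ∘ e₀≤e′ (g i) ∘ fwd (via (g i))) ,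
                 j , bwd (e₁≡ (g j)) j∈e , j∉e′ ∘ e₀≤e′ (g j) ∘ fwd (via (g j)))
    from : Restrict C (f ∘ g) S → Restrict (Restrict C f) g S
    from (e , Ce , S≡ , min) =
      preimage f e₀ , induced e₀ Ce₀ min₀ ,
      (λ j → S≡ j ⟫ mk⇔ (shrink j) (e₀≤e (g j)) ⟫ ⇔.sym (via (g j))) ,
      λ (e₁′ , (e₀′ , Ce₀′ , e₁′≡ , _) , below , j , j∈e₁ , j∉e₁′) →
        min (e₀′ , Ce₀′ ,
             (λ i → e₀≤e (g i) ∘ fwd (via (g i)) ∘ below i ∘ bwd (e₁′≡ (g i))) ,
             j , e₀≤e (g j) (fwd (via (g j)) j∈e₁) , j∉e₁′ ∘ bwd (e₁′≡ (g j)))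
      where
      e₀-data = minimalBelow f e Ce
      e₀ = proj₁ e₀-data
      Ce₀ = proj₁ (proj₂ e₀-data)
      e₀≤e = proj₁ (proj₂ (proj₂ e₀-data))
      min₀ = proj₂ (proj₂ (proj₂ e₀-data))
      via = ∈-subsetOf (λ i → f i ∈? e₀)
      -- e₀ cannot drop a vertex f (g j) of e, by (f ∘ g)-minimality of e
      shrink : ∀ j → f (g j) ∈ e → f (g j) ∈ e₀
      shrink j fgj∈e with f (g j) ∈? e₀
      ... | yes fgj∈e₀ = fgj∈e₀
      ... | no fgj∉e₀ = ⊥-elim (min (e₀ , Ce₀ , (λ i → e₀≤e (g i)) , j , fgj∈e , fgj∉e₀))

StrictlyIncreasing : {m n : ℕ} → (Fin m → Fin n) → Set
StrictlyIncreasing g = g Preserves Fin._<_ ⟶ Fin._<_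

increasing-grows : {m n : ℕ} (g : Fin m → Fin n) → StrictlyIncreasing g → ∀ j → toℕ j ℕ.≤ toℕ (g j)
increasing-grows g inc Fin.zero = z≤n
increasing-grows g inc (Fin.suc j) =
  ℕ.≤-trans (s≤s (increasing-grows (g ∘ Fin.inject₁) (inc ∘ inject₁-<) j)) (inc j<suc-j)
  where
  inject₁-< : ∀ {a b} → a Fin.< b → Fin.inject₁ a Fin.< Fin.inject₁ b
  inject₁-< {a} {b} = subst₂ ℕ._<_ (sym (toℕ-inject₁ a)) (sym (toℕ-inject₁ b))
  j<suc-j : Fin.inject₁ j Fin.< Fin.suc j
  j<suc-j = ℕ.≤-reflexive (cong suc (toℕ-inject₁ j))

opposite-reverses : {m : ℕ} {a b : Fin m} → a Fin.< b → opposite b Fin.< opposite a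
opposite-reverses {m} {a} {b} a<b =
  subst₂ ℕ._<_ (sym (opposite-prop b)) (sym (opposite-prop a)) (ℕ.∸-monoʳ-< (s≤s a<b) (toℕ<n b))

-- The only strictly increasing map of Fin m to itself is the identity: it
-- grows, and so does its conjugate by the order reversal opposite.
increasing-endo-id : {m : ℕ} (g : Fin m → Fin m) → StrictlyIncreasing g → g ≗ id
increasing-endo-id {m} g inc j = toℕ-injective (ℕ.≤-antisym g-j≤j (increasing-grows g inc j))
  where
  g* : Fin m → Fin m
  g* = opposite ∘ g ∘ opposite
  g*-grows : toℕ (opposite j) ℕ.≤ toℕ (opposite (g j))
  g*-grows = subst (λ x → toℕ (opposite j) ℕ.≤ toℕ (opposite (g x))) (opposite-involutive j)
               (increasing-grows g* (opposite-reverses ∘ inc ∘ opposite-reverses) (opposite j))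
  g-j≤j : toℕ (g j) ℕ.≤ toℕ j
  g-j≤j = ℕ.≮⇒≥ (λ j<g-j → ℕ.<⇒≱ (opposite-reverses j<g-j) g*-grows)

-- A map into a strictly larger Fin misses some vertex (else a choice of
-- preimages would inject the larger Fin into the smaller one).
missed-vertex : {t m : ℕ} (g : Fin m → Fin (suc t + m)) → ∃ λ u → ∀ j → g j ≢ u
missed-vertex {t} {m} g with any? (λ u → all? (λ j → ¬? (g j ≟ u)))
... | yes missed = missed
... | no ¬missed = ⊥-elim (ℕ.<⇒≱ (s≤s (ℕ.m≤n+m m t)) (injective⇒≤ preimage-injective))
  where
  hit : ∀ u → ∃ λ j → g j ≡ u
  hit u with any? (λ j → g j ≟ u)
  ... | yes found = found
  ... | no ¬found = ⊥-elim (¬missed (u , λ j gj≡u → ¬found (j , gj≡u)))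
  preimage-injective : ∀ {u v} → proj₁ (hit u) ≡ proj₁ (hit v) → u ≡ v
  preimage-injective {u} {v} same = trans (sym (proj₂ (hit u))) (trans (cong g same) (proj₂ (hit v)))

increasing-factor : {t m : ℕ} (g : Fin m → Fin (suc t + m)) → StrictlyIncreasing g →
                    ∃ λ u → ∃ λ (g′ : Fin m → Fin (t + m)) → StrictlyIncreasing g′ × (punchIn u ∘ g′ ≗ g)
increasing-factor {t} {m} g inc = u , g′ , g′-inc , punch-g′
  where
  u = proj₁ (missed-vertex g)
  u≢g : ∀ j → u ≢ g j
  u≢g j = proj₂ (missed-vertex g) j ∘ sym
  g′ : Fin m → Fin (t + m)
  g′ j = punchOut (u≢g j)
  punch-g′ : punchIn u ∘ g′ ≗ g
  punch-g′ j = punchIn-punchOut (u≢g j)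
  g′-inc : StrictlyIncreasing g′
  g′-inc {a} {b} a<b = ℕ.≰⇒> λ g′b≤g′a →
    ℕ.<⇒≱ (inc a<b) (subst₂ Fin._≤_ (punch-g′ b) (punch-g′ a) (punchIn-mono-≤ u (g′ b) (g′ a) g′b≤g′a))

module Contract {N : ℕ} (C : Clutter N) (C? : Decidable C) where
  open Descent C C? using (restrict-∘)

  -- Invariant: the current clutter E is the restriction of C along h.
  contract : (t : ℕ) {m : ℕ} (E : Clutter (t + m)) (h : Fin (t + m) → Fin N) → E ≋ Restrict C h →
             (g : Fin m → Fin (t + m)) → StrictlyIncreasing g →
             ∃ λ D → IsContraction E D × D ≋ Restrict C (h ∘ g)
  contract zero E h E≋ g inc =
    E , done , ≋-trans E≋ (restrict-cong C (λ j → cong h (sym (increasing-endo-id g inc j))))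
  contract (suc t) E h E≋ g inc =
    let (u , g′ , g′-inc , punch-g′) = increasing-factor g inc
        E/u≋ = ≋-trans (/-resp-≋ E≋ u) (≋-trans (contraction-as-restriction (Restrict C h) u) (restrict-∘ h (punchIn u)))
        (D , E/u↝D , D≋) = contract t (E / u) (h ∘ punchIn u) E/u≋ g′ g′-inc
    in D , step u E/u↝D , ≋-trans D≋ (restrict-cong C (cong h ∘ punch-g′))

contract-onto : {t m : ℕ} (C : Clutter (suc t + m)) → Decidable C →
                (g : Fin m → Fin (suc t + m)) → StrictlyIncreasing g →
                ∃ λ D → IsContraction C D × D ≋ Restrict C g
contract-onto {t} C C? g inc =
  let (u , g′ , g′-inc , punch-g′) = increasing-factor g inc
      (D , C/u↝D , D≋) = Contract.contract C C? t (C / u) (punchIn u) (contraction-as-restriction C u) g′ g′-inc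
  in D , step u C/u↝D , ≋-trans D≋ (restrict-cong C punch-g′)

Family : {I : Set} {N : ℕ} → (I → Fin N → Set) → Clutter N
Family W S = ∃ λ i → ∀ j → j ∈ S ⇔ W i j

restrict-family : {I A : Set} {N M : ℕ} (W : I → Fin N → Set) (V : A → Fin M → Set) →
  (∀ i → Decidable (W i)) → (∀ a → Decidable (V a)) → (f : Fin M → Fin N) →
  (covers : ∀ i → ∃ λ a → ∀ j → V a j → W i (f j)) →
  (traces : ∀ a → ∃ λ i → ∀ j → W i (f j) ⇔ V a j) →
  (antichain : ∀ a a′ → (∀ j → V a′ j → V a j) → ∀ j → V a j → V a′ j) →
  Restrict (Family W) f ≋ Family V
restrict-family W V W? V? f covers traces antichain S = mk⇔ to from
  where
  window : ∀ i → Family W (subsetOf (W? i))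
  window i = i , ∈-subsetOf (W? i)
  to : Restrict (Family W) f S → Family V S
  to (e , (i , e≡) , S≡ , min) with covers i
  ... | a , Va⊆Wi with any? (λ j → (f j ∈? e) ×-dec ¬? (V? a j))
  ...   | no ¬extra = a , λ j → S≡ j ⟫ mk⇔ (in-V j) (bwd (e≡ (f j)) ∘ Va⊆Wi j)
    where
    in-V : ∀ j → f j ∈ e → V a j
    in-V j fj∈e with V? a j
    ... | yes Vaj = Vaj
    ... | no ¬Vaj = ⊥-elim (¬extra (j , fj∈e , ¬Vaj))
  ...   | yes (j , fj∈e , ¬Vaj) =
    -- the pullback of a is traced by a circuit strictly below e
    let (i₂ , traced) = traces a
        via = ∈-subsetOf (W? i₂)
    in ⊥-elim (min (subsetOf (W? i₂) , window i₂ ,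
                    (λ j′ → bwd (e≡ (f j′)) ∘ Va⊆Wi j′ ∘ fwd (traced j′) ∘ fwd (via (f j′))) ,
                    j , fj∈e , ¬Vaj ∘ fwd (traced j) ∘ fwd (via (f j))))
  from : Family V S → Restrict (Family W) f S
  from (a , S≡) =
    subsetOf (W? i) , window i , (λ j → S≡ j ⟫ ⇔.sym (traced j) ⟫ ⇔.sym (via (f j))) ,
    λ (e′ , (i′ , e′≡) , below , j , fj∈e , fj∉e′) →
      let (a′ , Va′⊆Wi′) = covers i′
          Va′⊆Va : ∀ j → V a′ j → V a j
          Va′⊆Va j′ = fwd (traced j′) ∘ fwd (via (f j′)) ∘ below j′ ∘ bwd (e′≡ (f j′)) ∘ Va′⊆Wi′ j′
      in fj∉e′ (bwd (e′≡ (f j)) (Va′⊆Wi′ j (antichain a a′ Va′⊆Va j (fwd (traced j) (fwd (via (f j)) fj∈e)))))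
    where
    i = proj₁ (traces a)
    traced = proj₂ (traces a)
    via = ∈-subsetOf (W? i)

family? : {N r : ℕ} (W : Fin r → Fin N → Set) → (∀ i → Decidable (W i)) → Decidable (Family W)
family? W W? S = any? (λ i → all? (λ j → (j ∈? S) ⇔-dec W? i j))

≋⇒≅ : {m : ℕ} {C D : Clutter m} → C ≋ D → C ≅ D
≋⇒≅ {m} {D = D} C≋D = ↔-id (Fin m) , λ S → C≋D S ⟫ subst-⇔ D (sym (tabulate∘lookup S))

-- v lies in the window of length K starting at i of the cycle of length N,
-- unrolled to ℕ: some lift v + q N of v lies in [i, i + K).
InWindow : (N K i v : ℕ) → Set
InWindow N K i v = ∃ λ q → i ≤ v + q * N × v + q * N < i + K

module _ {N : ℕ} .{{_ : NonZero N}} where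

  window-shift : ∀ {K i v} c → v < N → InWindow N K i v ⇔ InWindow N K (i + c * N) v
  window-shift {K} {i} {v} c v<N = mk⇔ to from
    where
    lift-+ : ∀ v q c N → v + (q + c) * N ≡ v + q * N + c * N
    lift-+ = solve-∀
    end-+ : ∀ i c N K → i + c * N + K ≡ i + K + c * N
    end-+ = solve-∀
    to : InWindow N K i v → InWindow N K (i + c * N) v
    to (q , i≤ , <i+K) = q + c ,
      subst (i + c * N ≤_) (sym (lift-+ v q c N)) (ℕ.+-monoˡ-≤ (c * N) i≤) ,
      subst₂ _<_ (sym (lift-+ v q c N)) (sym (end-+ i c N K)) (ℕ.+-monoˡ-< (c * N) <i+K)
    from : InWindow N K (i + c * N) v → InWindow N K i v
    from (q , i+cN≤ , <i+cN+K) with c ℕ.≤? q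
    ... | yes c≤q = q ∸ c ,
          ℕ.+-cancelʳ-≤ (c * N) i _ (subst (i + c * N ≤_) (sym unshift) i+cN≤) ,
          ℕ.+-cancelʳ-< (c * N) _ (i + K) (subst₂ _<_ (sym unshift) (end-+ i c N K) <i+cN+K)
      where
      unshift : v + (q ∸ c) * N + c * N ≡ v + q * N
      unshift = trans (sym (lift-+ v (q ∸ c) c N)) (cong (λ p → v + p * N) (ℕ.m∸n+n≡m c≤q))
    ... | no c≰q = ⊥-elim (ℕ.<⇒≱ (begin-strict
            v + q * N  <⟨ ℕ.+-monoˡ-< (q * N) v<N ⟩
            suc q * N  ≤⟨ ℕ.*-monoˡ-≤ N (ℕ.≰⇒> c≰q) ⟩
            c * N      ≤⟨ ℕ.m≤n+m (c * N) i ⟩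
            i + c * N  ∎) i+cN≤)
      where open ℕ.≤-Reasoning

  window-mod-start : ∀ {K v} I → v < N → InWindow N K (I % N) v ⇔ InWindow N K I v
  window-mod-start {K} {v} I v<N =
    window-shift (I ℕ./ N) v<N ⟫ subst-⇔ (λ s → InWindow N K s v) (sym (m≡m%n+[m/n]*n I N))

  distance-≤ : ∀ {i v} → i ≤ v → v < N → (v + (N ∸ i)) % N ≡ v ∸ i
  distance-≤ {i} {v} i≤v v<N = begin
      (v + (N ∸ i)) % N        ≡⟨ cong (λ x → (x + (N ∸ i)) % N) (ℕ.m∸n+n≡m i≤v) ⟨
      ((v ∸ i) + i + (N ∸ i)) % N    ≡⟨ cong (_% N) (ℕ.+-assoc (v ∸ i) i (N ∸ i)) ⟩
      ((v ∸ i) + (i + (N ∸ i))) % N  ≡⟨ cong (λ x → ((v ∸ i) + x) % N) (ℕ.m+[n∸m]≡n (ℕ.≤-trans i≤v (ℕ.<⇒≤ v<N))) ⟩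
      ((v ∸ i) + N) % N        ≡⟨ [m+n]%n≡m%n (v ∸ i) N ⟩
      (v ∸ i) % N              ≡⟨ m<n⇒m%n≡m (ℕ.≤-<-trans (ℕ.m∸n≤m v i) v<N) ⟩
      v ∸ i                    ∎
    where open ≡-Reasoning

  distance-> : ∀ {i v} → v < i → i < N → (v + (N ∸ i)) % N ≡ v + (N ∸ i)
  distance-> {i} {v} v<i i<N = m<n⇒m%n≡m (begin-strict
      v + (N ∸ i)  <⟨ ℕ.+-monoˡ-< (N ∸ i) v<i ⟩
      i + (N ∸ i)  ≡⟨ ℕ.m+[n∸m]≡n (ℕ.<⇒≤ i<N) ⟩
      N            ∎)
    where open ℕ.≤-Reasoning

  distance<⇒window : ∀ {K i v} → i < N → v < N → (v + (N ∸ i)) % N < K → InWindow N K i v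
  distance<⇒window {K} {i} {v} i<N v<N d<K with i ℕ.≤? v
  ... | yes i≤v = 0 , ℕ.≤-trans i≤v (ℕ.m≤m+n v 0) , (begin-strict
        v + 0 * N        ≡⟨ ℕ.+-identityʳ v ⟩
        v                ≡⟨ ℕ.m+[n∸m]≡n i≤v ⟨
        i + (v ∸ i)      <⟨ ℕ.+-monoʳ-< i (subst (_< K) (distance-≤ i≤v v<N) d<K) ⟩
        i + K            ∎)
    where open ℕ.≤-Reasoning
  ... | no i≰v = 1 , ℕ.≤-trans (ℕ.<⇒≤ i<N) (subst (N ≤_) one-turn (ℕ.m≤n+m N v)) , (begin-strict
        v + 1 * N                ≡⟨ one-turn ⟨
        v + N                    ≡⟨ cong (v +_) (ℕ.m+[n∸m]≡n (ℕ.<⇒≤ i<N)) ⟨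
        v + (i + (N ∸ i))        ≡⟨ swap v i (N ∸ i) ⟩
        i + (v + (N ∸ i))        <⟨ ℕ.+-monoʳ-< i (subst (_< K) (distance-> (ℕ.≰⇒> i≰v) i<N) d<K) ⟩
        i + K                    ∎)
    where
    open ℕ.≤-Reasoning
    one-turn : v + N ≡ v + 1 * N
    one-turn = cong (v +_) (sym (ℕ.+-identityʳ N))
    swap : ∀ v i d → v + (i + d) ≡ i + (v + d)
    swap = solve-∀

  window⇒distance< : ∀ {K i v} → K ≤ N → i < N → InWindow N K i v → (v + (N ∸ i)) % N < K
  window⇒distance< {K} {i} {v} K≤N i<N (q , i≤ , <i+K) = subst (_< K) (sym distance) d<K
    where
    open ≡-Reasoning
    d = v + q * N ∸ i
    i+d : i + d ≡ v + q * N
    i+d = ℕ.m+[n∸m]≡n i≤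
    d<K : d < K
    d<K = ℕ.+-cancelˡ-< i d K (subst (_< i + K) (sym i+d) <i+K)
    reorder : ∀ a b c → a + b + c ≡ a + c + b
    reorder = solve-∀
    rotate : ∀ a b c → a + b + c ≡ b + (a + c)
    rotate = solve-∀
    lifted : v + (N ∸ i) + q * N ≡ d + 1 * N
    lifted = begin
      v + (N ∸ i) + q * N    ≡⟨ reorder v (N ∸ i) (q * N) ⟩
      (v + q * N) + (N ∸ i)  ≡⟨ cong (_+ (N ∸ i)) i+d ⟨
      i + d + (N ∸ i)        ≡⟨ rotate i d (N ∸ i) ⟩
      d + (i + (N ∸ i))      ≡⟨ cong (d +_) (trans (ℕ.m+[n∸m]≡n (ℕ.<⇒≤ i<N)) (sym (ℕ.+-identityʳ N))) ⟩
      d + 1 * N              ∎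
    distance : (v + (N ∸ i)) % N ≡ d
    distance = begin
      (v + (N ∸ i)) % N          ≡⟨ [m+kn]%n≡m%n (v + (N ∸ i)) q N ⟨
      (v + (N ∸ i) + q * N) % N  ≡⟨ cong (_% N) lifted ⟩
      (d + 1 * N) % N            ≡⟨ [m+kn]%n≡m%n d 1 N ⟩
      d % N                      ≡⟨ m<n⇒m%n≡m (ℕ.<-≤-trans d<K K≤N) ⟩
      d                          ∎

  window-start : ∀ {K} i → 1 ≤ K → InWindow N K i i
  window-start i 1≤K = 0 , ℕ.m≤m+n i 0 , subst (_< i + _) (sym (ℕ.+-identityʳ i)) (ℕ.m<m+n i 1≤K)

  window-full : ∀ {i v} → i < N → v < N → InWindow N N i v
  window-full {i} {v} i<N v<N with i ℕ.≤? v
  ... | yes i≤v = 0 , ℕ.≤-trans i≤v (ℕ.m≤m+n v 0) ,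
                  subst (_< i + N) (sym (ℕ.+-identityʳ v)) (ℕ.<-≤-trans v<N (ℕ.m≤n+m N i))
  ... | no i≰v = 1 , ℕ.≤-trans (ℕ.<⇒≤ i<N) (subst (N ≤_) lift (ℕ.m≤n+m N v)) ,
                 subst (_< i + N) lift (ℕ.+-monoˡ-< N (ℕ.≰⇒> i≰v))
    where
    lift : v + N ≡ v + 1 * N
    lift = cong (v +_) (sym (ℕ.+-identityʳ N))

  window-end-outside : ∀ {K} i → K < N → ¬ InWindow N K i ((i + K) % N)
  window-end-outside {K} i K<N (q , i≤ , <i+K) = ℕ.<⇒≱ K<N (ℕ.+-cancelˡ-≤ i N K (begin
      i + N              ≤⟨ ℕ.+-monoˡ-≤ N i≤ ⟩
      p + q * N + N      ≡⟨ ℕ.+-assoc p (q * N) N ⟩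
      p + (q * N + N)    ≡⟨ cong (p +_) (ℕ.+-comm (q * N) N) ⟩
      p + suc q * N      ≤⟨ ℕ.+-monoʳ-≤ p (ℕ.*-monoˡ-≤ N q<c) ⟩
      p + c * N          ≡⟨ end ⟨
      i + K              ∎))
    where
    open ℕ.≤-Reasoning
    p = (i + K) % N
    c = (i + K) ℕ./ N
    end : i + K ≡ p + c * N
    end = m≡m%n+[m/n]*n (i + K) N
    q<c : q < c
    q<c = ℕ.*-cancelʳ-< N q c (ℕ.+-cancelˡ-< p (q * N) (c * N) (subst (p + q * N <_) end <i+K))

  window-end-inside : ∀ {K} i z → i < z → z < i + K → InWindow N K z ((i + K) % N)
  window-end-inside {K} i z i<z z<i+K =
    (i + K) ℕ./ N , subst (z ≤_) end (ℕ.<⇒≤ z<i+K) , subst (_< z + K) end (ℕ.+-monoˡ-< K i<z)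
    where
    end : i + K ≡ (i + K) % N + (i + K) ℕ./ N * N
    end = m≡m%n+[m/n]*n (i + K) N

cyclic : (N K : ℕ) .{{_ : NonZero N}} → Fin N → Fin N → Set
cyclic N K i j = (toℕ j + (N ∸ toℕ i)) % N < K

cyclic? : (N K : ℕ) .{{_ : NonZero N}} (i : Fin N) → Decidable (cyclic N K i)
cyclic? N K i j = _ ℕ.<? K

startAt : (N : ℕ) .{{_ : NonZero N}} → ℕ → Fin N
startAt N I = fromℕ< (m%n<n I N)

module _ {N K : ℕ} .{{_ : NonZero N}} (K≤N : K ≤ N) where

  cyclic⇔window : ∀ i j → cyclic N K i j ⇔ InWindow N K (toℕ i) (toℕ j)
  cyclic⇔window i j = mk⇔ (distance<⇒window (toℕ<n i) (toℕ<n j)) (window⇒distance< K≤N (toℕ<n i))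

  cyclic-startAt : ∀ I j → cyclic N K (startAt N I) j ⇔ InWindow N K I (toℕ j)
  cyclic-startAt I j =
    cyclic⇔window (startAt N I) j ⟫
    subst-⇔ (λ s → InWindow N K s (toℕ j)) (toℕ-fromℕ< (m%n<n I N)) ⟫
    window-mod-start I (toℕ<n j)

  -- No circuit of Z N K (1 ≤ K) properly contains another: if K = N all
  -- windows are the whole cycle; otherwise a contains a lift A′ + q N of the
  -- start of a′, and if a′ ≠ a then the point K steps after a lies in a′
  -- but not in a.
  cyclic-antichain : 1 ≤ K → ∀ a a′ → (∀ j → cyclic N K a′ j → cyclic N K a j) →
                     ∀ j → cyclic N K a j → cyclic N K a′ j
  cyclic-antichain 1≤K a a′ a′⊆a j j∈a with K ℕ.≟ N
  ... | yes refl = bwd (cyclic⇔window a′ j) (window-full (toℕ<n a′) (toℕ<n j))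
  ... | no K≢N = subst (λ s → cyclic N K s j) (toℕ-injective A≡A′) j∈a
    where
    A = toℕ a
    A′ = toℕ a′
    a′⊆a-window : ∀ x → InWindow N K A′ (toℕ x) → InWindow N K A (toℕ x)
    a′⊆a-window x = fwd (cyclic⇔window a x) ∘ a′⊆a x ∘ bwd (cyclic⇔window a′ x)
    a′∈a = a′⊆a-window a′ (window-start A′ 1≤K)
    q = proj₁ a′∈a
    A≡A′ : A ≡ A′
    A≡A′ with A ℕ.≟ A′ + q * N
    ... | yes A≡lift = begin
          A                ≡⟨ m<n⇒m%n≡m (toℕ<n a) ⟨
          A % N            ≡⟨ cong (_% N) A≡lift ⟩
          (A′ + q * N) % N ≡⟨ [m+kn]%n≡m%n A′ q N ⟩
          A′ % N           ≡⟨ m<n⇒m%n≡m (toℕ<n a′) ⟩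
          A′               ∎
      where open ≡-Reasoning
    ... | no A≢lift = ⊥-elim (window-end-outside A (ℕ.≤∧≢⇒< K≤N K≢N) (subst (InWindow N K A) p≡ end∈a))
      where
      p = startAt N (A + K)
      p≡ : toℕ p ≡ (A + K) % N
      p≡ = toℕ-fromℕ< (m%n<n (A + K) N)
      end∈a′ : InWindow N K A′ (toℕ p)
      end∈a′ = subst (InWindow N K A′) (sym p≡) (bwd (window-shift q (m%n<n (A + K) N))
                 (window-end-inside A _ (ℕ.≤∧≢⇒< (proj₁ (proj₂ a′∈a)) A≢lift) (proj₂ (proj₂ a′∈a))))
      end∈a = a′⊆a-window p end∈a′

crossing : (g : ℕ → ℕ) (I b : ℕ) → g 0 < I → I ≤ g b → ∃ λ y → g y < I × I ≤ g (suc y)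
crossing g I zero g0<I I≤g0 = ⊥-elim (ℕ.<⇒≱ g0<I I≤g0)
crossing g I (suc b) g0<I I≤gb+1 with I ℕ.≤? g b
... | yes I≤gb = crossing g I b g0<I I≤gb
... | no I≰gb = b , ℕ.≰⇒> I≰gb , I≤gb+1

module Embedding (ℓ′ M′ L : ℕ) (Lℓ≤M : L * suc ℓ′ ≤ suc M′) (M≤[1+L]ℓ : suc M′ ≤ suc L * suc ℓ′) where

  ℓ M n k : ℕ
  ℓ = suc ℓ′
  M = suc M′
  n = ℓ + M
  k = suc L

  -- J x = ⌊x ℓ / M⌋ counts the missed vertices before F x.
  J : ℕ → ℕ
  J x = x * ℓ ℕ./ M

  J-lower : ∀ x → J x * M ≤ x * ℓ
  J-lower x = m/n*n≤m (x * ℓ) M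

  J-upper : ∀ x → x * ℓ < suc (J x) * M
  J-upper x = begin-strict
      x * ℓ                    ≡⟨ m≡m%n+[m/n]*n (x * ℓ) M ⟩
      (x * ℓ) % M + J x * M    <⟨ ℕ.+-monoˡ-< (J x * M) (m%n<n (x * ℓ) M) ⟩
      suc (J x) * M            ∎
    where open ℕ.≤-Reasoning

  J-least : ∀ {A} q → q * M ≤ A → q ≤ A ℕ./ M
  J-least {A} q qM≤A = subst (_≤ A ℕ./ M) (m*n/n≡m q M) (/-monoˡ-≤ M qM≤A)

  J-mono : ∀ {x y} → x ≤ y → J x ≤ J y
  J-mono x≤y = /-monoˡ-≤ M (ℕ.*-monoˡ-≤ ℓ x≤y)

  -- Over L steps J grows by at most one (L ℓ ≤ M) …
  J-slow : ∀ x → J (x + L) ≤ suc (J x)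
  J-slow x = ℕ.≤-pred (m<n*o⇒m/o<n (begin-strict
      (x + L) * ℓ              ≡⟨ ℕ.*-distribʳ-+ ℓ x L ⟩
      x * ℓ + L * ℓ            <⟨ ℕ.+-monoˡ-< (L * ℓ) (J-upper x) ⟩
      suc (J x) * M + L * ℓ    ≤⟨ ℕ.+-monoʳ-≤ (suc (J x) * M) Lℓ≤M ⟩
      suc (J x) * M + M        ≡⟨ ℕ.+-comm (suc (J x) * M) M ⟩
      suc (suc (J x)) * M      ∎))
    where open ℕ.≤-Reasoning

  -- … and over L + 1 steps by at least one (M ≤ (L + 1) ℓ).
  J-jumps : ∀ x → suc (J x) ≤ J (x + k)
  J-jumps x = J-least (suc (J x)) (begin
      M + J x * M              ≡⟨ ℕ.+-comm M (J x * M) ⟩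
      J x * M + M              ≤⟨ ℕ.+-mono-≤ (J-lower x) M≤[1+L]ℓ ⟩
      x * ℓ + k * ℓ            ≡⟨ ℕ.*-distribʳ-+ ℓ x k ⟨
      (x + k) * ℓ              ∎)
    where open ℕ.≤-Reasoning

  J-period : ∀ x → J (x + M) ≡ J x + ℓ
  J-period x = ℕ.≤-antisym (ℕ.≤-pred (m<n*o⇒m/o<n upper)) (J-least (J x + ℓ) lower)
    where
    open ℕ.≤-Reasoning
    shift : ∀ x M ℓ → (x + M) * ℓ ≡ x * ℓ + ℓ * M
    shift = solve-∀
    split : ∀ a ℓ M → (a + ℓ) * M ≡ a * M + ℓ * M
    split = solve-∀
    upper : (x + M) * ℓ < suc (J x + ℓ) * M
    upper = begin-strict
      (x + M) * ℓ              ≡⟨ shift x M ℓ ⟩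
      x * ℓ + ℓ * M            <⟨ ℕ.+-monoˡ-< (ℓ * M) (J-upper x) ⟩
      suc (J x) * M + ℓ * M    ≡⟨ split (suc (J x)) ℓ M ⟨
      suc (J x + ℓ) * M        ∎
    lower : (J x + ℓ) * M ≤ (x + M) * ℓ
    lower = begin
      (J x + ℓ) * M            ≡⟨ split (J x) ℓ M ⟩
      J x * M + ℓ * M          ≤⟨ ℕ.+-monoˡ-≤ (ℓ * M) (J-lower x) ⟩
      x * ℓ + ℓ * M            ≡⟨ shift x M ℓ ⟨
      (x + M) * ℓ              ∎

  F : ℕ → ℕ
  F x = x + J x

  F-mono-< : ∀ {x y} → x < y → F x < F y
  F-mono-< x<y = ℕ.+-mono-<-≤ x<y (J-mono (ℕ.<⇒≤ x<y))

  F-mono-≤ : ∀ {x y} → x ≤ y → F x ≤ F y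
  F-mono-≤ x≤y = ℕ.+-mono-≤ x≤y (J-mono x≤y)

  F-zero : F 0 ≡ 0
  F-zero = 0/n≡0 M

  F-grows : ∀ x → x ≤ F x
  F-grows x = ℕ.m≤m+n x (J x)

  F-period : ∀ x q → F (x + q * M) ≡ F x + q * n
  F-period x zero = trans (cong F (ℕ.+-identityʳ x)) (sym (ℕ.+-identityʳ (F x)))
  F-period x (suc q) = begin-equality
      F (x + (M + q * M))      ≡⟨ cong F (turn x M (q * M)) ⟩
      F (x + q * M + M)        ≡⟨ cong (x + q * M + M +_) (J-period (x + q * M)) ⟩
      x + q * M + M + (J (x + q * M) + ℓ)  ≡⟨ regroup (x + q * M) M (J (x + q * M)) ℓ ⟩
      F (x + q * M) + n        ≡⟨ cong (_+ n) (F-period x q) ⟩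
      F x + q * n + n          ≡⟨ turn′ (F x) (q * n) n ⟩
      F x + (n + q * n)        ∎
    where
    open ℕ.≤-Reasoning
    turn : ∀ x M b → x + (M + b) ≡ x + b + M
    turn = solve-∀
    regroup : ∀ y M a ℓ → y + M + (a + ℓ) ≡ y + a + (ℓ + M)
    regroup = solve-∀
    turn′ : ∀ a b n → a + b + n ≡ a + (n + b)
    turn′ = solve-∀

  F-bound : ∀ {j} → j < M → F j < n
  F-bound {j} j<M = subst (F j <_) (trans (cong (M +_) J-M) (ℕ.+-comm M ℓ)) (F-mono-< j<M)
    where
    J-M : J M ≡ ℓ
    J-M = trans (J-period 0) (cong (_+ ℓ) F-zero)

  F-reflects-< : ∀ {x y} → F x < F y → x < y
  F-reflects-< Fx<Fy = ℕ.≰⇒> (λ y≤x → ℕ.<⇒≱ Fx<Fy (F-mono-≤ y≤x))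

  F-upper : ∀ y → F (y + L) < suc (F y) + k
  F-upper y = s≤s (begin
      y + L + J (y + L)        ≤⟨ ℕ.+-monoʳ-≤ (y + L) (J-slow y) ⟩
      y + L + suc (J y)        ≡⟨ regroup y L (J y) ⟩
      F y + k                  ∎)
    where
    open ℕ.≤-Reasoning
    regroup : ∀ y L a → y + L + suc a ≡ (y + a) + suc L
    regroup = solve-∀

  F-lower : ∀ y → suc (F y) + k ≤ F (y + k)
  F-lower y = begin
      suc (F y) + k            ≡⟨ regroup y (J y) L ⟩
      y + k + suc (J y)        ≤⟨ ℕ.+-monoʳ-≤ (y + k) (J-jumps y) ⟩
      F (y + k)                ∎
    where
    open ℕ.≤-Reasoning
    regroup : ∀ y a L → suc (y + a) + suc L ≡ y + suc L + suc a
    regroup = solve-∀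

  F-interval : ∀ y z → (suc y ≤ z × z < suc y + L) ⇔ (suc (F y) ≤ F z × F z < suc (F y) + k)
  F-interval y z = mk⇔
    (λ (y<z , z<) → F-mono-< y<z , ℕ.≤-<-trans (F-mono-≤ (ℕ.≤-pred z<)) (F-upper y))
    (λ (Fy<Fz , Fz<) → F-reflects-< Fy<Fz ,
       subst (z <_) (ℕ.+-suc y L) (F-reflects-< (ℕ.<-≤-trans Fz< (F-lower y))))

  F-window : ∀ y x → InWindow n k (suc (F y)) (F x) ⇔ InWindow M L (suc y) x
  F-window y x = mk⇔
    (λ (q , bounds) → q , bwd (F-interval y (x + q * M)) (lift q bounds))
    (λ (q , bounds) → q , unlift q (fwd (F-interval y (x + q * M)) bounds))
    where
    lift : ∀ q → suc (F y) ≤ F x + q * n × F x + q * n < suc (F y) + k →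
           suc (F y) ≤ F (x + q * M) × F (x + q * M) < suc (F y) + k
    lift q (≤Fx , Fx<) = subst (suc (F y) ≤_) (sym (F-period x q)) ≤Fx ,
                         subst (_< suc (F y) + k) (sym (F-period x q)) Fx<
    unlift : ∀ q → suc (F y) ≤ F (x + q * M) × F (x + q * M) < suc (F y) + k →
             suc (F y) ≤ F x + q * n × F x + q * n < suc (F y) + k
    unlift q (≤Fx , Fx<) = subst (suc (F y) ≤_) (F-period x q) ≤Fx ,
                           subst (_< suc (F y) + k) (F-period x q) Fx<

  L≤M : L ≤ M
  L≤M = ℕ.≤-trans (ℕ.m≤m*n L ℓ) Lℓ≤M

  k≤n : k ≤ n
  k≤n = ℕ.+-mono-≤ (s≤s z≤n) L≤M

  f : Fin M → Fin n
  f j = fromℕ< (F-bound (toℕ<n j))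

  toℕ-f : ∀ j → toℕ (f j) ≡ F (toℕ j)
  toℕ-f j = toℕ-fromℕ< (F-bound (toℕ<n j))

  f-increasing : StrictlyIncreasing f
  f-increasing {a} {b} a<b = subst₂ _<_ (sym (toℕ-f a)) (sym (toℕ-f b)) (F-mono-< a<b)

  -- Every circuit of Z n k pulls back to a superset of a circuit of Z M L:
  -- the window at i (unrolled to I = i + n) starts after F y and ends after
  -- F (y + L), where y → y + 1 is the step at which F crosses I.
  covers : ∀ i → ∃ λ a → ∀ j → cyclic M L a j → cyclic n k i (f j)
  covers i = startAt M (suc y) , λ j →
    bwd (cyclic⇔window k≤n i (f j)) ∘
    subst (InWindow n k (toℕ i)) (sym (toℕ-f j)) ∘
    bwd (window-shift 1 (F-bound (toℕ<n j))) ∘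
    images-inside (toℕ j) ∘
    fwd (cyclic-startAt L≤M (suc y) j)
    where
    I = toℕ i + 1 * n
    F0<I : F 0 < I
    F0<I = subst (_< I) (sym F-zero) (ℕ.<-≤-trans (s≤s z≤n) (ℕ.m≤n+m (1 * n) (toℕ i)))
    crossed = crossing F I I F0<I (F-grows I)
    y = proj₁ crossed
    Fy<I = proj₁ (proj₂ crossed)
    I≤F[y+1] = proj₂ (proj₂ crossed)
    images-inside : ∀ x → InWindow M L (suc y) x → InWindow n k I (F x)
    images-inside x (q , y<x+qM , x+qM<) = q ,
      subst (I ≤_) (F-period x q) (ℕ.≤-trans I≤F[y+1] (F-mono-≤ y<x+qM)) ,
      subst (_< I + k) (F-period x q)
        (ℕ.<-≤-trans (ℕ.≤-<-trans (F-mono-≤ (ℕ.≤-pred x+qM<)) (F-upper y)) (ℕ.+-monoˡ-≤ k Fy<I))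

  -- Every circuit of Z M L, the window at a, is the pullback of the window
  -- of Z n k at F y + 1, where y + 1 = a + M.
  traces : ∀ a → ∃ λ i → ∀ j → cyclic n k i (f j) ⇔ cyclic M L a j
  traces a = startAt n (suc (F y)) , λ j →
    cyclic-startAt k≤n (suc (F y)) (f j) ⟫
    subst-⇔ (InWindow n k (suc (F y))) (toℕ-f j) ⟫
    F-window y (toℕ j) ⟫
    subst-⇔ (λ s → InWindow M L s (toℕ j)) y+1≡a+M ⟫
    ⇔.sym (window-shift 1 (toℕ<n j)) ⟫
    ⇔.sym (cyclic⇔window L≤M a j)
    where
    y = toℕ a + M′
    y+1≡a+M : suc y ≡ toℕ a + 1 * M
    y+1≡a+M = trans (sym (ℕ.+-suc (toℕ a) M′)) (cong (toℕ a +_) (sym (ℕ.+-identityʳ M)))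

  restriction-is-cyclic : 1 ≤ L → Restrict (Z n k) f ≋ Z M L
  restriction-is-cyclic 1≤L =
    restrict-family (cyclic n k) (cyclic M L) (cyclic? n k) (cyclic? M L) f
                    covers traces (cyclic-antichain L≤M 1≤L)

  contracts-to-cyclic : 1 ≤ L → ∃ λ D → IsContraction (Z n k) D × D ≅ Z M L
  contracts-to-cyclic 1≤L =
    let (D , Z↝D , D≋) = contract-onto (Z n k) (family? (cyclic n k) (cyclic? n k)) f f-increasing
    in D , Z↝D , ≋⇒≅ (≋-trans D≋ (restriction-is-cyclic 1≤L))

contraction-by-size : (ℓ′ L n M : ℕ) → suc ℓ′ + M ≡ n → 1 ≤ L →
  L * suc ℓ′ ≤ M → M ≤ suc L * suc ℓ′ →
  Σ ℕ λ m → Σ (Clutter m) λ D → IsContraction (Z n (suc L)) D × (D ≅ Z M L)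
contraction-by-size ℓ′ L n zero _ 1≤L Lℓ≤0 _ = ⊥-elim (ℕ.<⇒≱ (ℕ.*-mono-≤ 1≤L (s≤s z≤n)) Lℓ≤0)
contraction-by-size ℓ′ L _ (suc M′) refl 1≤L Lℓ≤M M≤[1+L]ℓ =
  suc M′ , Embedding.contracts-to-cyclic ℓ′ M′ L Lℓ≤M M≤[1+L]ℓ 1≤L

lemma7p4 : (n k ℓ : ℕ) → 1 ≤ n → 1 ≤ k → 1 ≤ ℓ →
           ℓ * k ≤ n → n ≤ ℓ * (k + 1) → 2 < k →
           Σ ℕ λ m → Σ (Clutter m) λ D →
             IsContraction (Z n k) D × (D ≅ Z (n ∸ ℓ) (k ∸ 1))
lemma7p4 n k zero _ _ () _ _ _
lemma7p4 n zero (suc ℓ′) _ () _ _ _ _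
lemma7p4 n (suc L) (suc ℓ′) _ _ _ ℓk≤n n≤ℓ[k+1] 2<k =
  contraction-by-size ℓ′ L n (n ∸ ℓ) (ℕ.m+[n∸m]≡n ℓ≤n) 1≤L Lℓ≤M M≤[1+L]ℓ
  where
  ℓ = suc ℓ′
  1≤L : 1 ≤ L
  1≤L = ℕ.≤-trans (s≤s z≤n) (ℕ.≤-pred 2<k)
  ℓk≡ : ∀ ℓ L → ℓ * suc L ≡ L * ℓ + ℓ
  ℓk≡ = solve-∀
  ℓ[k+1]≡ : ∀ ℓ L → ℓ * (suc L + 1) ≡ ℓ + suc L * ℓ
  ℓ[k+1]≡ = solve-∀
  Lℓ+ℓ≤n : L * ℓ + ℓ ≤ n
  Lℓ+ℓ≤n = subst (_≤ n) (ℓk≡ ℓ L) ℓk≤n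
  ℓ≤n : ℓ ≤ n
  ℓ≤n = ℕ.≤-trans (ℕ.m≤n+m ℓ (L * ℓ)) Lℓ+ℓ≤n
  Lℓ≤M : L * ℓ ≤ n ∸ ℓ
  Lℓ≤M = ℕ.m+n≤o⇒m≤o∸n (L * ℓ) Lℓ+ℓ≤n
  M≤[1+L]ℓ : n ∸ ℓ ≤ suc L * ℓ
  M≤[1+L]ℓ = ℕ.m≤n+o⇒m∸n≤o n ℓ (subst (n ≤_) (ℓ[k+1]≡ ℓ L) n≤ℓ[k+1])
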